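{- Let $D$ be a $3$-anti-circulant digraph such that every proper induced subdigraph of $D$ satisfies the BE-property, and let $S$ be a maximum stable set of $D$. If $D\in\mathfrak{D}$ and $D$ contains a transitive triangle $T$ with $V(T)\cap S\neq\emptyset$, then $D$ admits an $S_{BE}$-path partition.
   Context: Digraphs are finite, loopless, without multiple arcs (digons allowed); $u\to v$ means $uv$ is an arc. A transitive triangle in $D$ is a subdigraph (not necessarily induced) on three distinct vertices $a,b,c$ with arcs $ab$, $ac$, $bc$; it is induced if $D[\{a,b,c\}]$ has no other arcs. A stable set is a set of pairwise non-adjacent vertices. A path partition is a collection of vertex-disjoint (directed) paths covering $V(D)$. For a stable set $S$, an $S_{BE}$-path partition is a path partition in which each path contains exactly one vertex of $S$ and that vertex is the first or last vertex of the path. A digraph satisfies the BE-property if for every maximum stable set $S$ it admits an $S_{BE}$-path partition. An anti-$P_4$ is a set of four distinct vertices with $v_1\to v_2$, $v_3\to v_2$, $v_3\to v_4$; $D$ is $3$-anti-circulant if for every such anti-$P_4$, $v_4\to v_1$. A blocking odd cycle is a digraph whose underlying simple graph is a cycle $x_1x_2\dots x_{2k+1}x_1$, $k\ge1$, with $x_1$ a source and $x_2$ a sink; $\mathfrak{D}$ is the class of digraphs containing no induced subdigraph that is a blocking odd cycle. -}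

module Defs where

open import Data.Nat using (ℕ; zero; suc; _+_; _≤_; _<_)
open import Data.Nat.DivMod using (_%_)
open import Data.Fin using (Fin; toℕ)
open import Data.Fin.Subset using (Subset; _∈_; _∉_; ∣_∣)
open import Data.Bool using (Bool; true; false)
open import Data.List using (List; []; _∷_; _++_; [_]; concat; allFin)
open import Data.List.Relation.Unary.All using (All)
open import Data.List.Relation.Binary.Permutation.Propositional using (_↭_)
open import Data.Product using (Σ; ∃; ∃-syntax; _×_; _,_)
open import Data.Sum using (_⊎_)
open import Relation.Nullary using (¬_)
open import Relation.Binary.PropositionalEquality using (_≡_; _≢_)
open import Function.Bundles using (_⇔_)
open import Function.Definitions using (Injective)

-- A finite loopless digraph on vertex set Fin n (digons allowed,
-- no multiple arcs since arcs are given by a Boolean relation).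
record Digraph : Set where
  field
    n        : ℕ
    arc      : Fin n → Fin n → Bool
    loopless : ∀ v → arc v v ≡ false

open Digraph public

Arc : (D : Digraph) → Fin (n D) → Fin (n D) → Set
Arc D u v = arc D u v ≡ true

Adj : (D : Digraph) → Fin (n D) → Fin (n D) → Set
Adj D u v = Arc D u v ⊎ Arc D v u

-- induced subdigraph on the image of an injective map f : Fin m → V(D)
induced : (D : Digraph) {m : ℕ} (f : Fin m → Fin (n D)) → Digraph
induced D {m} f = record
  { n = m
  ; arc = λ i j → arc D (f i) (f j)
  ; loopless = λ i → loopless D (f i) }

Stable : (D : Digraph) → Subset (n D) → Set
Stable D S = ∀ u v → u ∈ S → v ∈ S → arc D u v ≡ false

MaxStable : (D : Digraph) → Subset (n D) → Set
MaxStable D S = Stable D S × (∀ T → Stable D T → ∣ T ∣ ≤ ∣ S ∣)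

data IsPath (D : Digraph) : List (Fin (n D)) → Set where
  single : ∀ v → IsPath D (v ∷ [])
  step   : ∀ u v p → Arc D u v → IsPath D (v ∷ p) → IsPath D (u ∷ v ∷ p)

-- path partition: list of paths whose concatenation is a permutation of V(D)
-- (i.e. vertex-disjoint paths covering V(D))
PathPartition : (D : Digraph) → List (List (Fin (n D))) → Set
PathPartition D P = All (IsPath D) P × (concat P ↭ allFin (n D))

BEPath : (D : Digraph) → Subset (n D) → List (Fin (n D)) → Set
BEPath D S p =
    (∃[ s ] ∃[ rest ] (p ≡ s ∷ rest × s ∈ S × All (_∉ S) rest))
  ⊎ (∃[ s ] ∃[ rest ] (p ≡ rest ++ [ s ] × s ∈ S × All (_∉ S) rest))

SBEPathPartition : (D : Digraph) → Subset (n D) → List (List (Fin (n D))) → Set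
SBEPathPartition D S P = PathPartition D P × All (BEPath D S) P

HasSBEPathPartition : (D : Digraph) → Subset (n D) → Set
HasSBEPathPartition D S = ∃[ P ] SBEPathPartition D S P

BEProperty : Digraph → Set
BEProperty D = ∀ S → MaxStable D S → HasSBEPathPartition D S

AllProperInducedBE : Digraph → Set
AllProperInducedBE D =
  ∀ {m} (f : Fin m → Fin (n D)) → Injective _≡_ _≡_ f → m < n D → BEProperty (induced D f)

ThreeAntiCirculant : Digraph → Set
ThreeAntiCirculant D =
  ∀ v₁ v₂ v₃ v₄ →
    v₁ ≢ v₂ → v₁ ≢ v₃ → v₁ ≢ v₄ → v₂ ≢ v₃ → v₂ ≢ v₄ → v₃ ≢ v₄ →
    Arc D v₁ v₂ → Arc D v₃ v₂ → Arc D v₃ v₄ → Arc D v₄ v₁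

-- adjacency in the cycle x₀ x₁ … x_{N-1} x₀ on Fin N
CycAdj : ∀ {N} → Fin (suc N) → Fin (suc N) → Set
CycAdj {N} i j = toℕ j ≡ suc (toℕ i) % suc N ⊎ toℕ i ≡ suc (toℕ j) % suc N

-- D has an induced blocking odd cycle of length 2k+1 = 3 + 2k' (k = k'+1 ≥ 1):
-- vertices x₀ … x_{2k} (images of f), the underlying simple graph of the induced
-- subdigraph is the cycle x₀x₁…x_{2k}x₀, x₀ is a source and x₁ a sink.
HasInducedBlockingOddCycle : Digraph → Set
HasInducedBlockingOddCycle D =
  ∃[ k' ] Σ (Fin (suc (suc (suc (k' + k')))) → Fin (n D)) λ f →
      Injective _≡_ _≡_ f
    × (∀ i j → (Adj D (f i) (f j) ⇔ CycAdj i j))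
    × (∀ j → arc D (f j) (f Fin.zero) ≡ false)
    × (∀ j → arc D (f (Fin.suc Fin.zero)) (f j) ≡ false)

InClassD : Digraph → Set
InClassD D = ¬ HasInducedBlockingOddCycle D

TransitiveTriangle : (D : Digraph) → Fin (n D) → Fin (n D) → Fin (n D) → Set
TransitiveTriangle D a b c =
  a ≢ b × a ≢ c × b ≢ c × Arc D a b × Arc D a c × Arc D b c

module Submission where

-- Let a → b, a → c, b → c be the triangle. An induced transitive triangle is a blocking odd
-- cycle of length 3, so D ∈ 𝔇 has none. Reversing all arcs preserves this, 3-anti-circulance
-- and S_BE-path partitions, so a source in S reduces to a sink in S.
--
-- If the sink c lies in S, delete b ∉ S. S is still a maximum stable set of D − b, so D − b has
-- an S_BE-path partition by hypothesis, and 3-anti-circulance shows that b can be inserted right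
-- after a, or right after the successor of a, on the path through a.
--
-- If b ∈ S, the triangle is not induced: b → a or c → b give a triangle with its S-vertex at the
-- source or the sink, and c → a gives a digon between a and c. Then delete a and c. The path
-- through b starts or ends at b; 3-anti-circulance propagates b → v forwards (resp. v → b
-- backwards) along it, so a, c can be attached at the other end.

open import Defs
open import Data.Bool using (true; false)
import Data.Bool.Properties as Bool
open import Data.Empty using (⊥; ⊥-elim)
open import Data.Fin as Fin using (Fin; zero; suc; punchIn)
open import Data.Fin.Patterns using (0F; 1F; 2F)
open import Data.Fin.Properties using (any?; punchIn-injective)
open import Data.Fin.Subset using (Subset; _∈_; _∉_; ∣_∣)
open import Data.Fin.Subset.Properties using (_∈?_; drop-there)
open import Data.List
  using (List; []; _∷_; _++_; [_]; concat; allFin; map; reverse; filter; length; tabulate)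
import Data.List.Properties as List
open import Data.List.Membership.Propositional using (find) renaming (_∈_ to _∈ₗ_; _∉_ to _∉ₗ_)
open import Data.List.Membership.Propositional.Properties
  using (∈-++⁻; ∈-++⁺ʳ; ∈-∃++; ∈-concat⁻; ∈-allFin; ∈-map⁻; ∈-map⁺)
open import Data.List.Relation.Binary.Permutation.Propositional
  using (_↭_; refl; prep; swap; trans; ↭-sym; ↭-reflexive; ↭⇒↭ₛ; module PermutationReasoning)
import Data.List.Relation.Binary.Permutation.Propositional.Properties as Perm
import Data.List.Relation.Binary.Permutation.Setoid.Properties as Permₛ
open import Data.List.Relation.Unary.All as All using (All; []; _∷_)
import Data.List.Relation.Unary.All.Properties as All
open import Data.List.Relation.Unary.Any using (here; there)
open import Data.List.Relation.Unary.Unique.Propositional using (Unique; []; _∷_)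
import Data.List.Relation.Unary.Unique.Propositional.Properties as Unique
open import Data.Nat using (ℕ; _+_; _≤_; _<_)
import Data.Nat as ℕ
import Data.Nat.Properties as ℕ
open import Data.Product using (Σ; ∃-syntax; _×_; _,_; proj₁; proj₂)
open import Data.Sum using (_⊎_; inj₁; inj₂; [_,_]′)
open import Data.Vec as Vec using ([]; _∷_)
import Data.Vec.Properties as Vec
open import Function using (_∘_; id)
open import Function.Bundles using (_⇔_; mk⇔; Equivalence)
open import Function.Definitions using (Injective)
open import Relation.Binary.PropositionalEquality
  using (_≡_; _≢_; refl; sym; cong; subst; subst₂; ≢-sym; setoid; module ≡-Reasoning)
  renaming (trans to ≡-trans)
open import Relation.Nullary using (¬_; Dec; yes; no; does; _×-dec_)
open import Relation.Nullary.Decidable using (dec-true)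
open import Relation.Unary using (Decidable)

module _ {A : Set} where

  Unique-resp-↭ : ∀ {xs ys : List A} → xs ↭ ys → Unique xs → Unique ys
  Unique-resp-↭ p = Permₛ.Unique-resp-↭ (setoid A) (↭⇒↭ₛ p)

  Unique-++⁻ˡ : ∀ (xs : List A) {ys} → Unique (xs ++ ys) → Unique xs
  Unique-++⁻ˡ []       _        = []
  Unique-++⁻ˡ (x ∷ xs) (x∉ ∷ u) = All.++⁻ˡ xs x∉ ∷ Unique-++⁻ˡ xs u

  Unique-++⁻ʳ : ∀ (xs : List A) {ys} → Unique (xs ++ ys) → Unique ys
  Unique-++⁻ʳ []       u       = u
  Unique-++⁻ʳ (x ∷ xs) (_ ∷ u) = Unique-++⁻ʳ xs u

  Unique-++⇒≢ : ∀ (xs : List A) {ys u v} → Unique (xs ++ ys) → u ∈ₗ xs → v ∈ₗ ys → u ≢ v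
  Unique-++⇒≢ (x ∷ xs) (x∉ ∷ _) (here refl) v∈ refl = All.lookup x∉ (∈-++⁺ʳ xs v∈) refl
  Unique-++⇒≢ (x ∷ xs) (_ ∷ u)  (there u∈)  v∈      = Unique-++⇒≢ xs u u∈ v∈

  concat⁺ : ∀ {P Q : List (List A)} → P ↭ Q → concat P ↭ concat Q
  concat⁺ refl            = refl
  concat⁺ (prep p P↭Q)    = Perm.++⁺ˡ p (concat⁺ P↭Q)
  concat⁺ (swap p q P↭Q)  = trans (Perm.shifts p q) (Perm.++⁺ˡ q (Perm.++⁺ˡ p (concat⁺ P↭Q)))
  concat⁺ (trans P↭Q Q↭R) = trans (concat⁺ P↭Q) (concat⁺ Q↭R)

  ∈-concat⇒↭ : ∀ {v} (P : List (List A)) → v ∈ₗ concat P → ∃[ p ] ∃[ Q ] (v ∈ₗ p × P ↭ p ∷ Q)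
  ∈-concat⇒↭ P v∈ with p , p∈P , v∈p ← find (∈-concat⁻ P v∈) with ys , zs , refl ← ∈-∃++ p∈P =
    p , ys ++ zs , v∈p , Perm.shift p ys zs

  concat-map-reverse : ∀ (P : List (List A)) → concat (map reverse P) ↭ concat P
  concat-map-reverse []      = refl
  concat-map-reverse (p ∷ P) = Perm.++⁺ (Perm.↭-reverse p) (concat-map-reverse P)

module _ {A : Set} {P : A → Set} where

  All-insert : ∀ xs {u b ys} → P b → All P (xs ++ u ∷ ys) → All P (xs ++ u ∷ b ∷ ys)
  All-insert []       pb (pu ∷ pys) = pu ∷ pb ∷ pys
  All-insert (x ∷ xs) pb (px ∷ pr)  = px ∷ All-insert xs pb pr

  ∷ʳ-All-insert : ∀ xs {u b y ys s} rest → xs ++ u ∷ y ∷ ys ≡ rest ++ [ s ] → P b → All P rest →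
                  ∃[ rest′ ] (xs ++ u ∷ b ∷ y ∷ ys ≡ rest′ ++ [ s ] × All P rest′)
  ∷ʳ-All-insert []       []         () _ _
  ∷ʳ-All-insert (x ∷ xs) []         eq _ _
    with () ← List.++-conicalʳ xs _ (proj₂ (List.∷-injective eq))
  ∷ʳ-All-insert []       (r ∷ rest) eq pb (pr ∷ prest) with refl , eq′ ← List.∷-injective eq =
    r ∷ _ ∷ rest , cong (λ t → r ∷ _ ∷ t) eq′ , pr ∷ pb ∷ prest
  ∷ʳ-All-insert (x ∷ xs) (r ∷ rest) eq pb (pr ∷ prest)
    with refl , eq′ ← List.∷-injective eq
    with rest′ , eq″ , prest′ ← ∷ʳ-All-insert xs rest eq′ pb prest =
    x ∷ rest′ , cong (x ∷_) eq″ , pr ∷ prest′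

length-filter-map : ∀ {A B : Set} {P : A → Set} {Q : B → Set} (P? : Decidable P) (Q? : Decidable Q)
                    (g : B → A) → (∀ x → P (g x) ⇔ Q x) →
                    ∀ xs → length (filter P? (map g xs)) ≡ length (filter Q? xs)
length-filter-map P? Q? g P∘g⇔Q []       = refl
length-filter-map P? Q? g P∘g⇔Q (x ∷ xs) with P? (g x) | Q? x
... | yes _ | yes _ = cong ℕ.suc (length-filter-map P? Q? g P∘g⇔Q xs)
... | yes p | no ¬q = ⊥-elim (¬q (Equivalence.to (P∘g⇔Q x) p))
... | no ¬p | yes q = ⊥-elim (¬p (Equivalence.from (P∘g⇔Q x) q))
... | no _  | no _  = length-filter-map P? Q? g P∘g⇔Q xs

count : ∀ {k} → Subset k → List (Fin k) → ℕ
count p xs = length (filter (_∈? p) xs)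

count-∷-suc : ∀ {k} x (p : Subset k) → count (x ∷ p) (tabulate suc) ≡ count p (allFin k)
count-∷-suc x p =
  ≡-trans (cong (count (x ∷ p)) (sym (List.map-tabulate id suc)))
          (length-filter-map (_∈? (x ∷ p)) (_∈? p) suc (λ _ → mk⇔ drop-there Vec.there) (allFin _))

∣p∣≡count-allFin : ∀ {k} (p : Subset k) → ∣ p ∣ ≡ count p (allFin k)
∣p∣≡count-allFin []          = refl
∣p∣≡count-allFin (true  ∷ p) = cong ℕ.suc (≡-trans (∣p∣≡count-allFin p) (sym (count-∷-suc true p)))
∣p∣≡count-allFin (false ∷ p) = ≡-trans (∣p∣≡count-allFin p) (sym (count-∷-suc false p))

select : ∀ {k} {P : Fin k → Set} → Decidable P → Subset k
select P? = Vec.tabulate (λ x → does (P? x))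

∈-select⁺ : ∀ {k} {P : Fin k → Set} (P? : Decidable P) {x} → P x → x ∈ select P?
∈-select⁺ P? {x} px = Vec.lookup⇒[]= x _ (≡-trans (Vec.lookup∘tabulate _ x) (dec-true (P? x) px))

∈-select⁻ : ∀ {k} {P : Fin k → Set} (P? : Decidable P) {x} → x ∈ select P? → P x
∈-select⁻ P? {x} x∈ with P? x | ≡-trans (sym (Vec.lookup∘tabulate _ x)) (Vec.[]=⇒lookup x∈)
... | yes px | _ = px
... | no _   | ()

arc⇒≢ : ∀ D {u v} → Arc D u v → u ≢ v
arc⇒≢ D {u} u→u refl with ≡-trans (sym u→u) (loopless D u)
... | ()

arc? : (D : Digraph) → ∀ u v → Dec (Arc D u v)
arc? D u v = arc D u v Bool.≟ true

module _ {D : Digraph} {S : Subset (n D)} (stable : Stable D S) where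

  source∈S⇒target∉S : ∀ {u v} → Arc D u v → u ∈ S → v ∉ S
  source∈S⇒target∉S {u} {v} u→v u∈S v∈S with ≡-trans (sym u→v) (stable u v u∈S v∈S)
  ... | ()

  target∈S⇒source∉S : ∀ {u v} → Arc D u v → v ∈ S → u ∉ S
  target∈S⇒source∉S u→v v∈S u∈S = source∈S⇒target∉S u→v u∈S v∈S

module AntiCirculant {D : Digraph} (A : ThreeAntiCirculant D) where

  close : ∀ {v₁ v₂ v₃ v₄} → v₁ ≢ v₃ → v₁ ≢ v₄ → v₂ ≢ v₄ →
          Arc D v₁ v₂ → Arc D v₃ v₂ → Arc D v₃ v₄ → Arc D v₄ v₁
  close v₁≢v₃ v₁≢v₄ v₂≢v₄ v₁→v₂ v₃→v₂ v₃→v₄ =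
    A _ _ _ _ (arc⇒≢ D v₁→v₂) v₁≢v₃ v₁≢v₄ (≢-sym (arc⇒≢ D v₃→v₂)) v₂≢v₄ (arc⇒≢ D v₃→v₄)
      v₁→v₂ v₃→v₂ v₃→v₄

NoInducedTransitiveTriangle : Digraph → Set
NoInducedTransitiveTriangle D =
  ∀ {x y z} → Arc D x y → Arc D x z → Arc D y z → Arc D y x ⊎ Arc D z x ⊎ Arc D z y

module _ {D : Digraph} {x y z : Fin (n D)} (x→y : Arc D x y) (x→z : Arc D x z) (y→z : Arc D y z)
         (y↛x : ¬ Arc D y x) (z↛x : ¬ Arc D z x) (z↛y : ¬ Arc D z y) where

  private
    cycle : Fin 3 → Fin (n D)
    cycle 0F = x
    cycle 1F = z
    cycle 2F = y

    x≢y : x ≢ y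
    x≢y = arc⇒≢ D x→y
    x≢z : x ≢ z
    x≢z = arc⇒≢ D x→z
    y≢z : y ≢ z
    y≢z = arc⇒≢ D y→z

    cycle-injective : Injective _≡_ _≡_ cycle
    cycle-injective {0F} {0F} _ = refl
    cycle-injective {1F} {1F} _ = refl
    cycle-injective {2F} {2F} _ = refl
    cycle-injective {0F} {1F} e = ⊥-elim (x≢z e)
    cycle-injective {0F} {2F} e = ⊥-elim (x≢y e)
    cycle-injective {1F} {0F} e = ⊥-elim (x≢z (sym e))
    cycle-injective {1F} {2F} e = ⊥-elim (y≢z (sym e))
    cycle-injective {2F} {0F} e = ⊥-elim (x≢y (sym e))
    cycle-injective {2F} {1F} e = ⊥-elim (y≢z e)

    ¬Adj-refl : ∀ {u} → ¬ Adj D u u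
    ¬Adj-refl (inj₁ u→u) = arc⇒≢ D u→u refl
    ¬Adj-refl (inj₂ u→u) = arc⇒≢ D u→u refl

    ¬CycAdj-refl : ∀ {i : Fin 3} → ¬ CycAdj i i
    ¬CycAdj-refl {0F} (inj₁ ())
    ¬CycAdj-refl {0F} (inj₂ ())
    ¬CycAdj-refl {1F} (inj₁ ())
    ¬CycAdj-refl {1F} (inj₂ ())
    ¬CycAdj-refl {2F} (inj₁ ())
    ¬CycAdj-refl {2F} (inj₂ ())

    cycle-adjacency : ∀ i j → Adj D (cycle i) (cycle j) ⇔ CycAdj i j
    cycle-adjacency 0F 0F = mk⇔ (⊥-elim ∘ ¬Adj-refl) (⊥-elim ∘ ¬CycAdj-refl)
    cycle-adjacency 1F 1F = mk⇔ (⊥-elim ∘ ¬Adj-refl) (⊥-elim ∘ ¬CycAdj-refl)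
    cycle-adjacency 2F 2F = mk⇔ (⊥-elim ∘ ¬Adj-refl) (⊥-elim ∘ ¬CycAdj-refl)
    cycle-adjacency 0F 1F = mk⇔ (λ _ → inj₁ refl) (λ _ → inj₁ x→z)
    cycle-adjacency 0F 2F = mk⇔ (λ _ → inj₂ refl) (λ _ → inj₁ x→y)
    cycle-adjacency 1F 0F = mk⇔ (λ _ → inj₂ refl) (λ _ → inj₂ x→z)
    cycle-adjacency 1F 2F = mk⇔ (λ _ → inj₁ refl) (λ _ → inj₂ y→z)
    cycle-adjacency 2F 0F = mk⇔ (λ _ → inj₁ refl) (λ _ → inj₂ x→y)
    cycle-adjacency 2F 1F = mk⇔ (λ _ → inj₂ refl) (λ _ → inj₁ y→z)

    x-source : ∀ j → arc D (cycle j) x ≡ false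
    x-source 0F = loopless D x
    x-source 1F = Bool.¬-not z↛x
    x-source 2F = Bool.¬-not y↛x

    z-sink : ∀ j → arc D z (cycle j) ≡ false
    z-sink 0F = Bool.¬-not z↛x
    z-sink 1F = loopless D z
    z-sink 2F = Bool.¬-not z↛y

  induced-transitive-triangle⇒blocking : HasInducedBlockingOddCycle D
  induced-transitive-triangle⇒blocking =
    0 , cycle , cycle-injective , cycle-adjacency , x-source , z-sink

InClassD⇒no-induced-transitive-triangle : ∀ {D} → InClassD D → NoInducedTransitiveTriangle D
InClassD⇒no-induced-transitive-triangle {D} D∈𝔇 {x} {y} {z} x→y x→z y→z
  with arc? D y x | arc? D z x | arc? D z y
... | yes y→x | _       | _       = inj₁ y→x
... | no _    | yes z→x | _       = inj₂ (inj₁ z→x)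
... | no _    | no _    | yes z→y = inj₂ (inj₂ z→y)
... | no y↛x  | no z↛x  | no z↛y  =
  ⊥-elim (D∈𝔇 (induced-transitive-triangle⇒blocking {D} x→y x→z y→z y↛x z↛x z↛y))

IsPath-split : ∀ {D} xs {u ys} → IsPath D (xs ++ u ∷ ys) → IsPath D (xs ++ [ u ]) × IsPath D (u ∷ ys)
IsPath-split []            p                   = single _ , p
IsPath-split (x ∷ [])      (step _ _ _ x→u p)  = step _ _ _ x→u (single _) , p
IsPath-split (x ∷ x′ ∷ xs) (step _ _ _ x→x′ p) =
  let l , r = IsPath-split (x′ ∷ xs) p in step _ _ _ x→x′ l , r

IsPath-join : ∀ {D} xs {u ys} → IsPath D (xs ++ [ u ]) → IsPath D (u ∷ ys) → IsPath D (xs ++ u ∷ ys)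
IsPath-join []            _                   r = r
IsPath-join (x ∷ [])      (step _ _ _ x→u _)  r = step _ _ _ x→u r
IsPath-join (x ∷ x′ ∷ xs) (step _ _ _ x→x′ l) r = step _ _ _ x→x′ (IsPath-join (x′ ∷ xs) l r)

-- When b becomes the last vertex, the vertex of S must be the first one; hence u ∉ S.
Insertable : (D : Digraph) → Subset (n D) → (b u : Fin (n D)) → List (Fin (n D)) → Set
Insertable D S b u []      = Arc D u b × u ∉ S
Insertable D S b u (y ∷ _) = Arc D u b × Arc D b y

IsPath-insert : ∀ {D S b} xs {u ys} → IsPath D (xs ++ u ∷ ys) → Insertable D S b u ys →
                IsPath D (xs ++ u ∷ b ∷ ys)
IsPath-insert xs {ys = []}    p (u→b , _) =
  IsPath-join xs (proj₁ (IsPath-split xs p)) (step _ _ _ u→b (single _))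
IsPath-insert xs {ys = _ ∷ _} p (u→b , b→y) with IsPath-split xs p
... | l , step _ _ _ _ r = IsPath-join xs l (step _ _ _ u→b (step _ _ _ b→y r))

BEPath-insert : ∀ {D S b} xs {u ys} → b ∉ S → Insertable D S b u ys →
                BEPath D S (xs ++ u ∷ ys) → BEPath D S (xs ++ u ∷ b ∷ ys)
BEPath-insert []       b∉S _ (inj₁ (s , rest , refl , s∈S , rest∉S)) =
  inj₁ (s , _ , refl , s∈S , b∉S ∷ rest∉S)
BEPath-insert (x ∷ xs) b∉S _ (inj₁ (s , rest , refl , s∈S , rest∉S)) =
  inj₁ (x , _ , refl , s∈S , All-insert xs b∉S rest∉S)
BEPath-insert {S = S} xs {ys = []} _ (_ , u∉S) (inj₂ (s , rest , eq , s∈S , _)) =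
  ⊥-elim (u∉S (subst (_∈ S) (sym (List.∷ʳ-injectiveʳ xs rest eq)) s∈S))
BEPath-insert xs {ys = _ ∷ _} b∉S _ (inj₂ (s , rest , eq , s∈S , rest∉S))
  with rest′ , eq′ , rest′∉S ← ∷ʳ-All-insert xs rest eq b∉S rest∉S =
  inj₂ (s , rest′ , eq′ , s∈S , rest′∉S)

BEPath-endpoint : ∀ {D S p v} → BEPath D S p → v ∈ S → v ∈ₗ p →
                    (∃[ rest ] (p ≡ v ∷ rest × All (_∉ S) rest))
                  ⊎ (∃[ rest ] (p ≡ rest ++ [ v ] × All (_∉ S) rest))
BEPath-endpoint (inj₁ (_ , rest , refl , _ , rest∉S)) _   (here refl) = inj₁ (rest , refl , rest∉S)
BEPath-endpoint (inj₁ (_ , rest , refl , _ , rest∉S)) v∈S (there v∈rest) =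
  ⊥-elim (All.lookup rest∉S v∈rest v∈S)
BEPath-endpoint (inj₂ (_ , rest , refl , _ , rest∉S)) v∈S v∈p with ∈-++⁻ rest v∈p
... | inj₁ v∈rest      = ⊥-elim (All.lookup rest∉S v∈rest v∈S)
... | inj₂ (here refl) = inj₂ (rest , refl , rest∉S)

converse : Digraph → Digraph
converse D = record { n = n D ; arc = λ u v → arc D v u ; loopless = loopless D }

converse-anti-circulant : ∀ {D} → ThreeAntiCirculant D → ThreeAntiCirculant (converse D)
converse-anti-circulant A v₁ v₂ v₃ v₄ v₁≢v₂ v₁≢v₃ v₁≢v₄ v₂≢v₃ v₂≢v₄ v₃≢v₄ v₂→v₁ v₂→v₃ v₄→v₃ =
  A v₄ v₃ v₂ v₁ (≢-sym v₃≢v₄) (≢-sym v₂≢v₄) (≢-sym v₁≢v₄) (≢-sym v₂≢v₃) (≢-sym v₁≢v₃) (≢-sym v₁≢v₂)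
    v₄→v₃ v₂→v₃ v₂→v₁

converse-no-induced-transitive-triangle :
  ∀ {D} → NoInducedTransitiveTriangle D → NoInducedTransitiveTriangle (converse D)
converse-no-induced-transitive-triangle I y→x z→x z→y with I z→y z→x y→x
... | inj₁ y→z        = inj₂ (inj₂ y→z)
... | inj₂ (inj₁ x→z) = inj₂ (inj₁ x→z)
... | inj₂ (inj₂ x→y) = inj₁ x→y

converse-stable : ∀ {D S} → Stable D S → Stable (converse D) S
converse-stable stable u v u∈S v∈S = stable v u v∈S u∈S

reverse-IsPath : ∀ {D p} → IsPath D p → IsPath (converse D) (reverse p)
reverse-IsPath (single v) = single v
reverse-IsPath {D} (step u v p u→v path) =
  subst (IsPath (converse D)) (sym reverse-unfold)
    (IsPath-join (reverse p)
      (subst (IsPath (converse D)) (List.unfold-reverse v p) (reverse-IsPath path))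
      (step v u [] u→v (single u)))
  where
  open ≡-Reasoning
  reverse-unfold : reverse (u ∷ v ∷ p) ≡ reverse p ++ v ∷ [ u ]
  reverse-unfold = begin
    reverse (u ∷ v ∷ p)           ≡⟨ List.unfold-reverse u (v ∷ p) ⟩
    reverse (v ∷ p) ++ [ u ]      ≡⟨ cong (_++ [ u ]) (List.unfold-reverse v p) ⟩
    (reverse p ++ [ v ]) ++ [ u ] ≡⟨ List.++-assoc (reverse p) [ v ] [ u ] ⟩
    reverse p ++ v ∷ [ u ]        ∎

reverse-BEPath : ∀ {D S p} → BEPath D S p → BEPath (converse D) S (reverse p)
reverse-BEPath (inj₁ (s , rest , refl , s∈S , rest∉S)) =
  inj₂ (s , reverse rest , List.unfold-reverse s rest , s∈S ,
        Perm.All-resp-↭ (↭-sym (Perm.↭-reverse rest)) rest∉S)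
reverse-BEPath (inj₂ (s , rest , refl , s∈S , rest∉S)) =
  inj₁ (s , reverse rest , List.reverse-++ rest [ s ] , s∈S ,
        Perm.All-resp-↭ (↭-sym (Perm.↭-reverse rest)) rest∉S)

-- P is an S_BE-path partition of D − X; for X = [] this is definitionally SBEPathPartition D S P.
SBEPathPartitionMinus : (D : Digraph) → Subset (n D) → List (Fin (n D)) → List (List (Fin (n D))) → Set
SBEPathPartitionMinus D S X P = (All (IsPath D) P × (X ++ concat P ↭ allFin (n D))) × All (BEPath D S) P

reverse-partition : ∀ {D S X P} → SBEPathPartitionMinus D S X P →
                    SBEPathPartitionMinus (converse D) S X (map reverse P)
reverse-partition {D} {S} {X} {P} ((paths , cover) , be) =
  (All.map⁺ (All.map reverse-IsPath paths) , trans (Perm.++⁺ˡ X (concat-map-reverse P)) cover) ,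
  All.map⁺ (All.map (reverse-BEPath {D} {S}) be)

converse-partition : ∀ {D S} → HasSBEPathPartition (converse D) S → HasSBEPathPartition D S
converse-partition (P , partition) = map reverse P , reverse-partition partition

module Partitions (D : Digraph) (S : Subset (n D)) where

  locate : ∀ {X P v} → SBEPathPartitionMinus D S X P → v ∉ₗ X →
           ∃[ p ] ∃[ Q ] (v ∈ₗ p × SBEPathPartitionMinus D S X (p ∷ Q))
  locate {X} {P} {v} ((paths , cover) , be) v∉X
    with ∈-++⁻ X (Perm.∈-resp-↭ (↭-sym cover) (∈-allFin v))
  ... | inj₁ v∈X = ⊥-elim (v∉X v∈X)
  ... | inj₂ v∈P with p , Q , v∈p , P↭ ← ∈-concat⇒↭ P v∈P =
    p , Q , v∈p ,
    (Perm.All-resp-↭ P↭ paths , trans (Perm.++⁺ˡ X (concat⁺ (↭-sym P↭))) cover) ,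
    Perm.All-resp-↭ P↭ be

  Unique-path : ∀ {X p Q} → SBEPathPartitionMinus D S X (p ∷ Q) → Unique (X ++ p)
  Unique-path {X} {p} {Q} ((_ , cover) , _) =
    Unique-++⁻ˡ (X ++ p)
      (subst Unique (sym (List.++-assoc X p (concat Q)))
        (Unique-resp-↭ (↭-sym cover) (Unique.allFin⁺ (n D))))

  replace : ∀ {X Y p Q p′} → SBEPathPartitionMinus D S (Y ++ X) (p ∷ Q) →
            IsPath D p′ → BEPath D S p′ → p′ ↭ Y ++ p → SBEPathPartitionMinus D S X (p′ ∷ Q)
  replace {X} {Y} {p} {Q} {p′} ((_ ∷ paths , cover) , _ ∷ be) path′ be′ p′↭ =
    (path′ ∷ paths , cover′) , be′ ∷ be
    where
    open PermutationReasoning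
    cover′ : X ++ p′ ++ concat Q ↭ allFin (n D)
    cover′ = begin
      X ++ p′ ++ concat Q        ↭⟨ Perm.++⁺ˡ X (Perm.++⁺ʳ (concat Q) p′↭) ⟩
      X ++ (Y ++ p) ++ concat Q  ≡⟨ cong (X ++_) (List.++-assoc Y p (concat Q)) ⟩
      X ++ Y ++ p ++ concat Q    ↭⟨ Perm.shifts X Y ⟩
      Y ++ X ++ p ++ concat Q    ≡⟨ List.++-assoc Y X (p ++ concat Q) ⟨
      (Y ++ X) ++ p ++ concat Q  ↭⟨ cover ⟩
      allFin (n D)               ∎

  insert : ∀ {X p Q xs u ys b} → SBEPathPartitionMinus D S (b ∷ X) (p ∷ Q) → p ≡ xs ++ u ∷ ys →
           b ∉ S → Insertable D S b u ys → SBEPathPartitionMinus D S X ((xs ++ u ∷ b ∷ ys) ∷ Q)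
  insert {X} {xs = xs} {u} {ys} {b} partition@((path ∷ _ , _) , be ∷ _) refl b∉S ins =
    replace {X = X} {Y = [ b ]} partition (IsPath-insert xs path ins) (BEPath-insert xs b∉S ins be)
      (trans (Perm.++⁺ˡ xs (swap u b refl)) (Perm.shift b xs (u ∷ ys)))

-- f enumerates the vertices outside X, so that induced D f is D − X.
ComplementEnumeration : ∀ {N} → List (Fin N) → Set
ComplementEnumeration {N} X =
  ∃[ m ] Σ (Fin m → Fin N) λ f → Injective _≡_ _≡_ f × (X ++ map f (allFin m) ↭ allFin N)

punchIn-↭ : ∀ {m} (i : Fin (ℕ.suc m)) → i ∷ tabulate (punchIn i) ↭ allFin (ℕ.suc m)
punchIn-↭ zero              = refl
punchIn-↭ {ℕ.suc m} (suc i) =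
  trans (swap (suc i) zero refl)
        (prep zero (subst₂ _↭_ (cong (suc i ∷_) (List.map-tabulate (punchIn i) suc))
                               (List.map-tabulate id suc)
                               (Perm.map⁺ suc (punchIn-↭ i))))

complement-enumeration : ∀ {N} {X : List (Fin N)} → Unique X → ComplementEnumeration X
complement-enumeration {N} [] = N , id , id , ↭-reflexive (List.map-id (allFin N))
complement-enumeration {N} {x ∷ X} (x∉X ∷ X!)
  with m , f , f-injective , enum ← complement-enumeration X!
  with ∈-++⁻ X (Perm.∈-resp-↭ (↭-sym enum) (∈-allFin x))
... | inj₁ x∈X = ⊥-elim (All.lookup x∉X x∈X refl)
... | inj₂ x∈f[Fin] with i , _ , refl ← ∈-map⁻ f x∈f[Fin] = remove i f-injective enum
  where
  remove : ∀ {m} (i : Fin m) {f : Fin m → Fin N} → Injective _≡_ _≡_ f →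
           X ++ map f (allFin m) ↭ allFin N → ComplementEnumeration (f i ∷ X)
  remove {ℕ.suc m} i {f} f-injective enum =
    m , f ∘ punchIn i , punchIn-injective i _ _ ∘ f-injective , enum′
    where
    open PermutationReasoning
    enum′ : f i ∷ X ++ map (f ∘ punchIn i) (allFin m) ↭ allFin N
    enum′ = begin
      f i ∷ X ++ map (f ∘ punchIn i) (allFin m)   ↭⟨ Perm.shift (f i) X _ ⟨
      X ++ f i ∷ map (f ∘ punchIn i) (allFin m)   ≡⟨ cong (λ t → X ++ f i ∷ t) (List.map-∘ (allFin m)) ⟩
      X ++ map f (i ∷ map (punchIn i) (allFin m)) ≡⟨ cong (λ t → X ++ map f (i ∷ t))
                                                          (List.map-tabulate id (punchIn i)) ⟩
      X ++ map f (i ∷ tabulate (punchIn i))       ↭⟨ Perm.++⁺ˡ X (Perm.map⁺ f (punchIn-↭ i)) ⟩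
      X ++ map f (allFin (ℕ.suc m))               ↭⟨ enum ⟩
      allFin N                                    ∎

complement-enumeration-< : ∀ {N m x X} {f : Fin m → Fin N} →
                           x ∷ X ++ map f (allFin m) ↭ allFin N → m < N
complement-enumeration-< {N} {m} {x} {X} {f} enum = begin-strict
  m                                    ≤⟨ ℕ.m≤n+m m (length X) ⟩
  length X + m                         ≡⟨ cong (length X +_) length-f[Fin] ⟨
  length X + length (map f (allFin m)) ≡⟨ List.length-++ X ⟨
  length (X ++ map f (allFin m))       <⟨ ℕ.n<1+n _ ⟩
  length (x ∷ X ++ map f (allFin m))   ≡⟨ Perm.↭-length enum ⟩
  length (allFin N)                    ≡⟨ List.length-tabulate id ⟩
  N                                    ∎
  where
  open ℕ.≤-Reasoning
  length-f[Fin] : length (map f (allFin m)) ≡ m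
  length-f[Fin] = ≡-trans (List.length-map f (allFin m)) (List.length-tabulate id)

module Restriction {D : Digraph} {X : List (Fin (n D))} {m} (f : Fin m → Fin (n D))
                   (f-injective : Injective _≡_ _≡_ f)
                   (enum : X ++ map f (allFin m) ↭ allFin (n D)) where

  preimage? : ∀ p → Decidable (λ i → f i ∈ p)
  preimage? p i = f i ∈? p

  preimage : Subset (n D) → Subset m
  preimage p = select (preimage? p)

  image? : ∀ q → Decidable (λ x → ∃[ i ] (f i ≡ x × i ∈ q))
  image? q x = any? (λ i → (f i Fin.≟ x) ×-dec (i ∈? q))

  image : Subset m → Subset (n D)
  image q = select (image? q)

  X∉image : ∀ q → All (_∉ image q) X
  X∉image q = All.tabulate λ x∈X x∈image →
    let i , fi≡x , _ = ∈-select⁻ (image? q) x∈image in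
    Unique-++⇒≢ X (Unique-resp-↭ (↭-sym enum) (Unique.allFin⁺ _)) x∈X (∈-map⁺ f (∈-allFin i)) (sym fi≡x)

  ∣∣-transfer : ∀ p q → All (_∉ p) X → (∀ i → f i ∈ p ⇔ i ∈ q) → ∣ p ∣ ≡ ∣ q ∣
  ∣∣-transfer p q X∉p ∈p∘f⇔∈q = begin
    ∣ p ∣                                  ≡⟨ ∣p∣≡count-allFin p ⟩
    count p (allFin (n D))                 ≡⟨ Perm.↭-length (Perm.filter-↭ (_∈? p) enum) ⟨
    count p (X ++ map f (allFin m))        ≡⟨ cong length (List.filter-++ (_∈? p) X _) ⟩
    length (filter (_∈? p) X ++ filter (_∈? p) (map f (allFin m)))
                                           ≡⟨ List.length-++ (filter (_∈? p) X) ⟩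
    count p X + count p (map f (allFin m)) ≡⟨ cong (λ k → k + count p (map f (allFin m)))
                                                   (cong length (List.filter-none (_∈? p) X∉p)) ⟩
    count p (map f (allFin m))             ≡⟨ length-filter-map (_∈? p) (_∈? q) f ∈p∘f⇔∈q (allFin m) ⟩
    count q (allFin m)                     ≡⟨ ∣p∣≡count-allFin q ⟨
    ∣ q ∣                                  ∎
    where open ≡-Reasoning

  module _ {S : Subset (n D)} (maxS : MaxStable D S) (X∉S : All (_∉ S) X) where

    preimage-stable : Stable (induced D f) (preimage S)
    preimage-stable i j i∈ j∈ =
      proj₁ maxS (f i) (f j) (∈-select⁻ (preimage? S) i∈) (∈-select⁻ (preimage? S) j∈)

    preimage-maximum : ∀ T → Stable (induced D f) T → ∣ T ∣ ≤ ∣ preimage S ∣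
    preimage-maximum T T-stable = begin
      ∣ T ∣          ≡⟨ ∣∣-transfer (image T) T (X∉image T) ∈image∘f⇔∈ ⟨
      ∣ image T ∣    ≤⟨ proj₂ maxS (image T) image-stable ⟩
      ∣ S ∣          ≡⟨ ∣∣-transfer S (preimage S) X∉S ∈S∘f⇔∈preimage ⟩
      ∣ preimage S ∣ ∎
      where
      open ℕ.≤-Reasoning
      ∈image∘f⇔∈ : ∀ i → f i ∈ image T ⇔ i ∈ T
      ∈image∘f⇔∈ i = mk⇔ (λ fi∈ → let j , fj≡fi , j∈T = ∈-select⁻ (image? T) fi∈ in
                                   subst (_∈ T) (f-injective fj≡fi) j∈T)
                          (λ i∈T → ∈-select⁺ (image? T) (i , refl , i∈T))
      ∈S∘f⇔∈preimage : ∀ i → f i ∈ S ⇔ i ∈ preimage S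
      ∈S∘f⇔∈preimage _ = mk⇔ (∈-select⁺ (preimage? S)) (∈-select⁻ (preimage? S))
      image-stable : Stable D (image T)
      image-stable u v u∈ v∈ with ∈-select⁻ (image? T) u∈ | ∈-select⁻ (image? T) v∈
      ... | i , refl , i∈T | j , refl , j∈T = T-stable i j i∈T j∈T

    lift-IsPath : ∀ {q} → IsPath (induced D f) q → IsPath D (map f q)
    lift-IsPath (single _)            = single _
    lift-IsPath (step _ _ _ i→j path) = step _ _ _ i→j (lift-IsPath path)

    lift-∉ : ∀ {is} → All (_∉ preimage S) is → All (_∉ S) (map f is)
    lift-∉ is∉ = All.map⁺ (All.map (λ i∉ fi∈ → i∉ (∈-select⁺ (preimage? S) fi∈)) is∉)

    lift-BEPath : ∀ {q} → BEPath (induced D f) (preimage S) q → BEPath D S (map f q)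
    lift-BEPath (inj₁ (s , rest , refl , s∈ , rest∉)) =
      inj₁ (f s , map f rest , refl , ∈-select⁻ (preimage? S) s∈ , lift-∉ rest∉)
    lift-BEPath (inj₂ (s , rest , refl , s∈ , rest∉)) =
      inj₂ (f s , map f rest , List.map-++ f rest [ s ] , ∈-select⁻ (preimage? S) s∈ , lift-∉ rest∉)

    lift-partition : ∀ {P} → SBEPathPartition (induced D f) (preimage S) P →
                     SBEPathPartitionMinus D S X (map (map f) P)
    lift-partition {P} ((paths , cover) , be) =
      (All.map⁺ (All.map lift-IsPath paths) ,
       trans (↭-reflexive (cong (X ++_) (List.concat-map P)))
             (trans (Perm.++⁺ˡ X (Perm.map⁺ f cover)) enum)) ,
      All.map⁺ (All.map lift-BEPath be)

    restrict : AllProperInducedBE D → m < n D → ∃[ P ] SBEPathPartitionMinus D S X P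
    restrict allBE m<n
      with P , partition ← allBE f f-injective m<n (preimage S) (preimage-stable , preimage-maximum) =
      map (map f) P , lift-partition partition

delete-outside : ∀ {D S} → MaxStable D S → AllProperInducedBE D → ∀ {x X} →
                 Unique (x ∷ X) → All (_∉ S) (x ∷ X) → ∃[ P ] SBEPathPartitionMinus D S (x ∷ X) P
delete-outside maxS allBE X! X∉S with m , f , f-injective , enum ← complement-enumeration X! =
  Restriction.restrict f f-injective enum maxS X∉S allBE (complement-enumeration-< enum)

module SinkCase {D : Digraph} {S : Subset (n D)} (A : ThreeAntiCirculant D)
                (I : NoInducedTransitiveTriangle D) (stable : Stable D S) {a b c : Fin (n D)}
                (a→b : Arc D a b) (a→c : Arc D a c) (b→c : Arc D b c) (c∈S : c ∈ S) where

  open AntiCirculant {D} A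
  open Partitions D S

  private
    b↛⇒≢c : ∀ {v} → ¬ Arc D b v → v ≢ c
    b↛⇒≢c b↛v v≡c = b↛v (subst (Arc D b) (sym v≡c) b→c)

    →c⇒∉S : ∀ {u} → Arc D u c → u ∉ S
    →c⇒∉S u→c = target∈S⇒source∉S {D} stable u→c c∈S

    c→⇒∉S : ∀ {u} → Arc D c u → u ∉ S
    c→⇒∉S c→u = source∈S⇒target∉S {D} stable c→u c∈S

    a∉[b] : a ∉ₗ [ b ]
    a∉[b] (here a≡b) = arc⇒≢ D a→b a≡b

  successor-of-a→b : ∀ {y} → Arc D a y → b ≢ y → ¬ Arc D b y → Arc D y b
  successor-of-a→b a→y b≢y b↛y = close (arc⇒≢ D a→b ∘ sym) b≢y (≢-sym (b↛⇒≢c b↛y)) b→c a→c a→y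

  →b⇒c→ : ∀ {y} → Arc D y b → a ≢ y → ¬ Arc D b y → Arc D c y
  →b⇒c→ y→b a≢y b↛y = close (≢-sym a≢y) (b↛⇒≢c b↛y) (arc⇒≢ D b→c) y→b a→b a→c

  second-successor : ∀ {y y′} → Arc D a y → Arc D y b → ¬ Arc D b y → Arc D y y′ → a ≢ y′ → b ≢ y′ →
                     Arc D b y′
  second-successor {y} {y′} a→y y→b b↛y y→y′ a≢y′ b≢y′ with arc? D b y′
  ... | yes b→y′ = b→y′
  ... | no b↛y′  = ⊥-elim (triangle (I a→y a→b y→b))
    where
    y′→a : Arc D y′ a
    y′→a = close (arc⇒≢ D a→y) a≢y′ b≢y′ a→b y→b y→y′
    c→y : Arc D c y
    c→y = →b⇒c→ y→b (arc⇒≢ D a→y) b↛y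
    c→y′ : Arc D b a → Arc D c y′
    c→y′ b→a = close (≢-sym b≢y′) (b↛⇒≢c b↛y′) (arc⇒≢ D a→c) y′→a b→a b→c
    triangle : Arc D y a ⊎ Arc D b a ⊎ Arc D b y → ⊥
    triangle (inj₂ (inj₂ b→y)) = b↛y b→y
    triangle (inj₁ y→a) = b↛y′ (close (arc⇒≢ D y→y′ ∘ sym) (≢-sym b≢y′) (arc⇒≢ D a→b) y′→a y→a y→b)
    triangle (inj₂ (inj₁ b→a)) with I c→y (c→y′ b→a) y→y′
    ... | inj₁ y→c         = b↛y (close (arc⇒≢ D a→y ∘ sym) (arc⇒≢ D y→b) (arc⇒≢ D b→c ∘ sym) y→c a→c a→b)
    ... | inj₂ (inj₁ y′→c) = b↛y′ (close (≢-sym a≢y′) (≢-sym b≢y′) (arc⇒≢ D b→c ∘ sym) y′→c a→c a→b)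
    ... | inj₂ (inj₂ y′→y) = b↛y′ (close (≢-sym a≢y′) (≢-sym b≢y′) (arc⇒≢ D y→b) y′→y a→y a→b)

  insertion-point : ∀ post → IsPath D (a ∷ post) → All (b ≢_) post → All (a ≢_) post →
                    ∃[ xs ] ∃[ u ] ∃[ ys ] (a ∷ post ≡ xs ++ u ∷ ys × Insertable D S b u ys)
  insertion-point []         _                     _                _            =
    [] , a , [] , refl , a→b , →c⇒∉S a→c
  insertion-point (y ∷ post) (step _ _ _ a→y path) (b≢y ∷ b≢post) (_ ∷ a≢post) with arc? D b y
  ... | yes b→y = [] , a , y ∷ post , refl , a→b , b→y
  ... | no b↛y  = [ a ] , y , post , refl , after-y post path b≢post a≢post
    where
    y→b : Arc D y b
    y→b = successor-of-a→b a→y b≢y b↛y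
    after-y : ∀ post → IsPath D (y ∷ post) → All (b ≢_) post → All (a ≢_) post →
              Insertable D S b y post
    after-y []      _                   _          _          =
      y→b , c→⇒∉S (→b⇒c→ y→b (arc⇒≢ D a→y) b↛y)
    after-y (_ ∷ _) (step _ _ _ y→y′ _) (b≢y′ ∷ _) (a≢y′ ∷ _) =
      y→b , second-successor a→y y→b b↛y y→y′ a≢y′ b≢y′

  insert-b : ∀ {P} → SBEPathPartitionMinus D S [ b ] P → HasSBEPathPartition D S
  insert-b partition
    with p , Q , a∈p , partition′@((path ∷ _ , _) , _) ← locate partition a∉[b]
    with pre , post , refl ← ∈-∃++ a∈p
    with b≢p ∷ p! ← Unique-path {X = [ b ]} partition′
    with _ ∷ b≢post ← All.++⁻ʳ pre {a ∷ post} b≢p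
    with a≢post ∷ _ ← Unique-++⁻ʳ pre {a ∷ post} p!
    with xs , u , ys , eq , ins ← insertion-point post (proj₂ (IsPath-split pre path)) b≢post a≢post =
    _ , insert {X = []} partition′ (≡-trans (cong (pre ++_) eq) (sym (List.++-assoc pre xs (u ∷ ys))))
                (→c⇒∉S b→c) ins

module PairCase {D : Digraph} {S : Subset (n D)} (A : ThreeAntiCirculant D) {a b c : Fin (n D)}
                (a→b : Arc D a b) (b→c : Arc D b c) (c→a : Arc D c a) (a→c : Arc D a c)
                (b∈S : b ∈ S) (a∉S : a ∉ S) (c∉S : c ∉ S) where

  open AntiCirculant {D} A
  open Partitions D S

  Avoids : Fin (n D) → Set
  Avoids u = a ≢ u × c ≢ u × u ∉ S

  private
    b≢ : ∀ {u} → Avoids u → b ≢ u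
    b≢ (_ , _ , u∉S) b≡u = u∉S (subst (_∈ S) b≡u b∈S)

  b→⇒→a : ∀ {y} → Avoids y → Arc D b y → Arc D y a
  b→⇒→a (a≢y , c≢y , _) b→y = close (arc⇒≢ D a→b) a≢y c≢y a→c b→c b→y

  b→-step : ∀ {y y′} → Avoids y → Avoids y′ → Arc D b y → Arc D y y′ → Arc D b y′
  b→-step {y′ = y′} ok@(_ , c≢y , _) ok′@(a≢y′ , c≢y′ , _) b→y y→y′ =
    close (≢-sym a≢y′) (≢-sym (b≢ ok′)) (arc⇒≢ D b→c ∘ sym) y′→c a→c a→b
    where
    y′→c : Arc D y′ c
    y′→c = close c≢y c≢y′ a≢y′ c→a (b→⇒→a ok b→y) y→y′

  →b⇒c→ : ∀ {x} → Avoids x → Arc D x b → Arc D c x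
  →b⇒c→ (a≢x , c≢x , _) x→b = close (≢-sym a≢x) (≢-sym c≢x) (arc⇒≢ D b→c) x→b a→b a→c

  →b-step : ∀ {x x′} → Avoids x → Avoids x′ → Arc D x x′ → Arc D x′ b → Arc D x b
  →b-step {x} ok@(a≢x , c≢x , _) ok′@(a≢x′ , _ , _) x→x′ x′→b =
    close (arc⇒≢ D a→b ∘ sym) (b≢ ok) c≢x b→c a→c a→x
    where
    a→x : Arc D a x
    a→x = close (≢-sym c≢x) (≢-sym a≢x) (≢-sym a≢x′) x→x′ (→b⇒c→ ok′ x′→b) c→a

  path-from-b : ∀ y ys → IsPath D (y ∷ ys) → Arc D b y → All Avoids (y ∷ ys) →
                IsPath D (y ∷ ys ++ a ∷ [ c ])
  path-from-b y []        _                      b→y (ok ∷ [])  =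
    step _ _ _ (b→⇒→a ok b→y) (step _ _ _ a→c (single c))
  path-from-b y (y′ ∷ ys) (step _ _ _ y→y′ path) b→y (ok ∷ oks) =
    step _ _ _ y→y′ (path-from-b y′ ys path (b→-step ok (All.head oks) b→y y→y′) oks)

  path-to-b : ∀ x xs → IsPath D (x ∷ xs ++ [ b ]) → All Avoids (x ∷ xs) → Arc D x b
  path-to-b x []        (step _ _ _ x→b _)     _          = x→b
  path-to-b x (x′ ∷ xs) (step _ _ _ x→x′ path) (ok ∷ oks) =
    →b-step ok (All.head oks) x→x′ (path-to-b x′ xs path oks)

  b∷c∷a : ∃[ p′ ] (IsPath D p′ × BEPath D S p′ × p′ ↭ a ∷ c ∷ b ∷ [])
  b∷c∷a = b ∷ c ∷ a ∷ [] ,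
          step _ _ _ b→c (step _ _ _ c→a (single a)) ,
          inj₁ (b , c ∷ a ∷ [] , refl , b∈S , c∉S ∷ a∉S ∷ []) ,
          Perm.↭-reverse (a ∷ c ∷ b ∷ [])

  absorb : ∀ {p} → IsPath D p → BEPath D S p → b ∈ₗ p → All (a ≢_) p → All (c ≢_) p →
           ∃[ p′ ] (IsPath D p′ × BEPath D S p′ × p′ ↭ a ∷ c ∷ p)
  absorb path be b∈p a≢p c≢p with BEPath-endpoint {D} be b∈S b∈p
  ... | inj₁ ([] , refl , _) = b∷c∷a
  ... | inj₂ ([] , refl , _) = b∷c∷a
  absorb (step _ _ _ b→y path) _ _ (_ ∷ a≢rest) (_ ∷ c≢rest) | inj₁ (y ∷ ys , refl , rest∉S) =
    b ∷ y ∷ ys ++ a ∷ [ c ] ,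
    step _ _ _ b→y (path-from-b y ys path b→y (All.zip (a≢rest , All.zip (c≢rest , rest∉S)))) ,
    inj₁ (b , _ , refl , b∈S , All.++⁺ rest∉S (a∉S ∷ c∉S ∷ [])) ,
    Perm.++-comm (b ∷ y ∷ ys) (a ∷ [ c ])
  absorb path _ _ a≢p c≢p | inj₂ (x ∷ xs , refl , rest∉S) =
    a ∷ c ∷ x ∷ xs ++ [ b ] ,
    step _ _ _ a→c (step _ _ _ (→b⇒c→ (All.head oks) (path-to-b x xs path oks)) path) ,
    inj₂ (b , a ∷ c ∷ x ∷ xs , refl , b∈S , a∉S ∷ c∉S ∷ rest∉S) ,
    refl
    where
    oks : All Avoids (x ∷ xs)
    oks = All.zip (All.++⁻ˡ (x ∷ xs) a≢p , All.zip (All.++⁻ˡ (x ∷ xs) c≢p , rest∉S))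

  private
    b∉[a,c] : b ∉ₗ a ∷ c ∷ []
    b∉[a,c] (here b≡a)         = arc⇒≢ D a→b (sym b≡a)
    b∉[a,c] (there (here b≡c)) = arc⇒≢ D b→c b≡c

  absorb-a-c : ∀ {P} → SBEPathPartitionMinus D S (a ∷ c ∷ []) P → HasSBEPathPartition D S
  absorb-a-c partition
    with p , Q , b∈p , partition′@((path ∷ _ , _) , be ∷ _) ← locate partition b∉[a,c]
    with (_ ∷ a≢p) ∷ c≢p ∷ _ ← Unique-path {X = a ∷ c ∷ []} partition′
    with p′ , path′ , be′ , p′↭ ← absorb path be b∈p a≢p c≢p =
    _ , replace {X = []} {Y = a ∷ c ∷ []} partition′ path′ be′ p′↭

module Triangle {D : Digraph} {S : Subset (n D)} (A : ThreeAntiCirculant D)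
                (I : NoInducedTransitiveTriangle D) (allBE : AllProperInducedBE D)
                (maxS : MaxStable D S) where

  private
    stable : Stable D S
    stable = proj₁ maxS

    delete : ∀ {y} → y ∉ S → ∃[ P ] SBEPathPartitionMinus D S [ y ] P
    delete y∉S = delete-outside {D} maxS allBE ([] ∷ []) (y∉S ∷ [])

  sink∈S : ∀ {x y z} → Arc D x y → Arc D x z → Arc D y z → z ∈ S → HasSBEPathPartition D S
  sink∈S x→y x→z y→z z∈S =
    SinkCase.insert-b A I stable x→y x→z y→z z∈S
      (proj₂ (delete (target∈S⇒source∉S {D} stable y→z z∈S)))

  source∈S : ∀ {x y z} → Arc D x y → Arc D x z → Arc D y z → x ∈ S → HasSBEPathPartition D S
  source∈S x→y x→z y→z x∈S =
    converse-partition
      (SinkCase.insert-b (converse-anti-circulant {D} A) (converse-no-induced-transitive-triangle {D} I)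
        (converse-stable {D} stable) y→z x→z x→y x∈S
        (reverse-partition (proj₂ (delete (source∈S⇒target∉S {D} stable x→y x∈S)))))

  middle∈S : ∀ {x y z} → Arc D x y → Arc D x z → Arc D y z → y ∈ S → HasSBEPathPartition D S
  middle∈S {x} {y} {z} x→y x→z y→z y∈S with I x→y x→z y→z
  ... | inj₁ y→x        = source∈S y→x y→z x→z y∈S
  ... | inj₂ (inj₂ z→y) = sink∈S x→z x→y z→y y∈S
  ... | inj₂ (inj₁ z→x) =
    PairCase.absorb-a-c A x→y y→z z→x x→z y∈S x∉S z∉S
      (proj₂ (delete-outside {D} maxS allBE ((arc⇒≢ D x→z ∷ []) ∷ [] ∷ []) (x∉S ∷ z∉S ∷ [])))
    where
    x∉S : x ∉ S
    x∉S = target∈S⇒source∉S {D} stable x→y y∈S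
    z∉S : z ∉ S
    z∉S = source∈S⇒target∉S {D} stable y→z y∈S

lemma14 : (D : Digraph) → ThreeAntiCirculant D → AllProperInducedBE D →
    (S : Subset (n D)) → MaxStable D S → InClassD D →
    (∃[ a ] ∃[ b ] ∃[ c ] (TransitiveTriangle D a b c × (a ∈ S ⊎ b ∈ S ⊎ c ∈ S))) →
    HasSBEPathPartition D S
lemma14 D A allBE S maxS D∈𝔇 (a , b , c , (_ , _ , _ , a→b , a→c , b→c) , T∩S≢∅) =
  [ source∈S a→b a→c b→c , [ middle∈S a→b a→c b→c , sink∈S a→b a→c b→c ]′ ]′ T∩S≢∅
  where open Triangle {D} A (InClassD⇒no-induced-transitive-triangle {D} D∈𝔇) allBE maxS
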